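{- $b(n) = n\left(1-\mathcal{O}\left(\frac{1}{\log n}\right)\right)$ as $n\to\infty$; in particular $b(n)=n(1-o(1))$.
   Context: The Thue–Morse sequence $\mathbf{t}=t_0t_1t_2\cdots$ is the infinite binary sequence with $t_i$ equal to the parity of the number of $1$'s in the binary representation of $i$. $b(n)$ denotes the length of a longest common subsequence of the length-$n$ prefix of $\mathbf{t}$ and the bitwise complement of that prefix. -}

module Defs where

open import Data.Bool using (Bool; true; false; not; _xor_)
open import Data.Nat using (ℕ; zero; suc; _≤_; _≡ᵇ_)
open import Data.Nat.DivMod using (_/_; _%_)
open import Data.List using (List; length; map; tabulate)
open import Data.Fin using (toℕ)
open import Data.Product using (_×_; Σ)
open import Relation.Binary.PropositionalEquality using (_≡_)
open import Data.List.Relation.Binary.Sublist.Propositional using (_⊆_)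

-- parity of the number of 1's in the binary expansion of m, computed with
-- fuel; fuel ≥ number of binary digits of m suffices (fuel = m always works).
bitParity : ℕ → ℕ → Bool
bitParity zero      m = false
bitParity (suc f) m = (m % 2 ≡ᵇ 1) xor bitParity f (m / 2)

t : ℕ → Bool
t i = bitParity i i

prefix : ℕ → List Bool
prefix n = tabulate {n = n} (λ i → t (toℕ i))

complement : List Bool → List Bool
complement = map not

CommonSubseq : List Bool → List Bool → List Bool → Set
CommonSubseq zs xs ys = (zs ⊆ xs) × (zs ⊆ ys)

IsLCSLength : List Bool → List Bool → ℕ → Set
IsLCSLength xs ys k =
  Σ (List Bool) (λ zs → CommonSubseq zs xs ys × length zs ≡ k)
  × ((zs : List Bool) → CommonSubseq zs xs ys → length zs ≤ k)

IsB : ℕ → ℕ → Set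
IsB n k = IsLCSLength (prefix n) (complement (prefix n)) k

module Submission where

-- Let L = 2^c.  Since t(i·L + r) = t(i) xor t(r) for r < L, the prefix
-- of length 2(q+1)L is a concatenation of blocks
--     U^{t₀} U^{¬t₀} U^{t₁} U^{¬t₁} ⋯ U^{t_q} U^{¬t_q},     U = prefix L,
-- where U^b is U complemented when b is true.  Its complement is the same word
-- with all exponents negated.  Dropping the first block of the word and aligning
-- the rest block by block with the complement, every other pair of blocks is
-- equal (L matches) and the remaining pairs are U against U or Ū (at least
-- b(L) matches).  So the defect n − b(n) is at most r + L + q·(L − b(L)),
-- where n = 2(q+1)L + r.  Choosing c ≈ ¾⌊log₂ n⌋, the terms r + L contribute
-- at most 12n/⌊log₂ n⌋ and the q·(L − b(L)) term at most 24n/⌊log₂ n⌋, so the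
-- bound follows by strong induction on n.

open import Defs
open import Data.Bool using (Bool; true; false; not; _xor_)
open import Data.Bool.Properties using (not-distribˡ-xor; not-distribʳ-xor; xor-identityʳ)
  renaming (_≟_ to _≟ᴮ_)
open import Data.Nat
  using (ℕ; zero; suc; _≤_; _<_; _*_; _∸_; _+_; _^_; z≤n; s≤s; _≤?_; _≡ᵇ_; ⌊_/2⌋; ⌈_/2⌉; NonZero)
open import Data.Nat.Properties
open import Data.Nat.DivMod
open import Data.Nat.Logarithm using (⌊log₂_⌋; ⌊log₂[2^n]⌋≡n)
open import Data.Nat.Logarithm.Core using (⌊log2⌋)
open import Data.Nat.Induction using (<-rec; <-wellFounded)
open import Data.Nat.Tactic.RingSolver using (solve-∀)
open import Data.List using (List; []; _∷_; length; map; _++_; tabulate)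
open import Data.List.Properties using (map-++; ++-assoc; length-map; length-++; length-tabulate; map-∘; map-cong)
open import Data.List.Relation.Binary.Sublist.Propositional using (_⊆_; []; _∷ʳ_; _∷_; minimum; ⊆-refl)
open import Data.List.Relation.Binary.Sublist.Propositional.Properties
  using (++⁺; ++⁺ˡ; ++⁺ʳ; map⁺; length-mono-≤)
open import Data.Fin using (Fin; toℕ) renaming (zero to fzero; suc to fsuc)
open import Data.Product using (Σ; _×_; _,_; proj₁; proj₂)
open import Induction.WellFounded using (Acc; acc)
open import Relation.Binary.Definitions using (DecidableEquality)
open import Relation.Nullary using (yes; no; contradiction)
open import Relation.Binary.PropositionalEquality

-- (1) Longest common subsequences over any alphabet with decidable equality.

module LongestCommonSubsequence {A : Set} (_≟_ : DecidableEquality A) where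

  Common : List A → List A → Set
  Common xs ys = Σ (List A) λ zs → zs ⊆ xs × zs ⊆ ys

  size : ∀ {xs ys} → Common xs ys → ℕ
  size c = length (proj₁ c)

  longer : ∀ {xs ys} → Common xs ys → Common xs ys → Common xs ys
  longer c d with size c ≤? size d
  ... | yes _ = d
  ... | no  _ = c

  longer-≥ˡ : ∀ {xs ys} (c d : Common xs ys) → size c ≤ size (longer c d)
  longer-≥ˡ c d with size c ≤? size d
  ... | yes c≤d = c≤d
  ... | no  _   = ≤-refl

  longer-≥ʳ : ∀ {xs ys} (c d : Common xs ys) → size d ≤ size (longer c d)
  longer-≥ʳ c d with size c ≤? size d
  ... | yes _   = ≤-refl
  ... | no  c≰d = <⇒≤ (≰⇒> c≰d)

  skipˡ : ∀ {xs ys} x → Common xs ys → Common (x ∷ xs) ys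
  skipˡ x (zs , p , q) = zs , x ∷ʳ p , q

  skipʳ : ∀ {xs ys} y → Common xs ys → Common xs (y ∷ ys)
  skipʳ y (zs , p , q) = zs , p , y ∷ʳ q

  keepHeads : ∀ {xs ys} x y → Common xs ys → Common (x ∷ xs) (y ∷ ys) → Common (x ∷ xs) (y ∷ ys)
  keepHeads x y (zs , p , q) d with x ≟ y
  ... | yes refl = longer (x ∷ zs , refl ∷ p , refl ∷ q) d
  ... | no  _    = d

  keepHeads-≥ : ∀ {xs ys} x y (c : Common xs ys) d → size d ≤ size (keepHeads x y c d)
  keepHeads-≥ x y (zs , p , q) d with x ≟ y
  ... | yes refl = longer-≥ʳ (x ∷ zs , refl ∷ p , refl ∷ q) d
  ... | no  _    = ≤-refl

  keepHeads-extends : ∀ {xs ys} x (c : Common xs ys) d → suc (size c) ≤ size (keepHeads x x c d)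
  keepHeads-extends x (zs , p , q) d with x ≟ x
  ... | yes refl = longer-≥ˡ (x ∷ zs , refl ∷ p , refl ∷ q) d
  ... | no  x≢x  = contradiction refl x≢x

  lcs : (xs ys : List A) → Common xs ys
  lcs []       ys       = [] , [] , minimum ys
  lcs (x ∷ xs) []       = [] , minimum (x ∷ xs) , []
  lcs (x ∷ xs) (y ∷ ys) =
    keepHeads x y (lcs xs ys) (longer (skipˡ x (lcs xs (y ∷ ys))) (skipʳ y (lcs (x ∷ xs) ys)))

  skipping : ∀ x y xs ys → Common (x ∷ xs) (y ∷ ys)
  skipping x y xs ys = longer (skipˡ x (lcs xs (y ∷ ys))) (skipʳ y (lcs (x ∷ xs) ys))

  skipping-≤ : ∀ x y xs ys → size (skipping x y xs ys) ≤ size (lcs (x ∷ xs) (y ∷ ys))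
  skipping-≤ x y xs ys = keepHeads-≥ x y (lcs xs ys) (skipping x y xs ys)

  lcs-maximal : ∀ xs ys zs → zs ⊆ xs → zs ⊆ ys → length zs ≤ size (lcs xs ys)
  lcs-maximal xs ys [] p q = z≤n
  lcs-maximal (x ∷ xs) (y ∷ ys) (z ∷ zs) (.x ∷ʳ p) q =
    ≤-trans (lcs-maximal xs (y ∷ ys) (z ∷ zs) p q)
            (≤-trans (longer-≥ˡ (skipˡ x (lcs xs (y ∷ ys))) (skipʳ y (lcs (x ∷ xs) ys)))
                     (skipping-≤ x y xs ys))
  lcs-maximal (x ∷ xs) (y ∷ ys) (z ∷ zs) p (.y ∷ʳ q) =
    ≤-trans (lcs-maximal (x ∷ xs) ys (z ∷ zs) p q)
            (≤-trans (longer-≥ʳ (skipˡ x (lcs xs (y ∷ ys))) (skipʳ y (lcs (x ∷ xs) ys)))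
                     (skipping-≤ x y xs ys))
  lcs-maximal (x ∷ xs) (.x ∷ ys) (.x ∷ zs) (refl ∷ p) (refl ∷ q) =
    ≤-trans (s≤s (lcs-maximal xs ys zs p q)) (keepHeads-extends x (lcs xs ys) (skipping x x xs ys))

  lcs-≤-length : ∀ xs ys → size (lcs xs ys) ≤ length xs
  lcs-≤-length xs ys = length-mono-≤ (proj₁ (proj₂ (lcs xs ys)))

open LongestCommonSubsequence _≟ᴮ_

lcs-≥ : ∀ xs ys zs → CommonSubseq zs xs ys → length zs ≤ size (lcs xs ys)
lcs-≥ xs ys zs (p , q) = lcs-maximal xs ys zs p q

lcs-isLCS : ∀ xs ys → IsLCSLength xs ys (size (lcs xs ys))
lcs-isLCS xs ys = (proj₁ (lcs xs ys) , proj₂ (lcs xs ys) , refl) , lcs-≥ xs ys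

HasCommon : List Bool → List Bool → ℕ → Set
HasCommon xs ys ℓ = Σ (List Bool) λ zs → CommonSubseq zs xs ys × ℓ ≤ length zs

common-refl : ∀ xs → HasCommon xs xs (length xs)
common-refl xs = xs , (⊆-refl , ⊆-refl) , ≤-refl

common-weaken : ∀ {xs ys ℓ ℓ′} → ℓ′ ≤ ℓ → HasCommon xs ys ℓ → HasCommon xs ys ℓ′
common-weaken ℓ′≤ℓ (zs , common , ℓ≤) = zs , common , ≤-trans ℓ′≤ℓ ℓ≤

common-++ : ∀ {xs ys us vs ℓ ℓ′} → HasCommon xs ys ℓ → HasCommon us vs ℓ′ →
            HasCommon (xs ++ us) (ys ++ vs) (ℓ + ℓ′)
common-++ {ℓ = ℓ} (zs , (p , q) , ℓ≤) (ws , (p′ , q′) , ℓ′≤) =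
  zs ++ ws , (++⁺ p p′ , ++⁺ q q′) , subst (ℓ + _ ≤_) (sym (length-++ zs)) (+-mono-≤ ℓ≤ ℓ′≤)

common-padˡ : ∀ {xs ys ℓ} ws → HasCommon xs ys ℓ → HasCommon (ws ++ xs) ys ℓ
common-padˡ ws (zs , (p , q) , ℓ≤) = zs , (++⁺ˡ ws p , q) , ℓ≤

common-padʳ : ∀ {xs ys ℓ} us vs → HasCommon xs ys ℓ → HasCommon (xs ++ us) (ys ++ vs) ℓ
common-padʳ us vs (zs , (p , q) , ℓ≤) = zs , (++⁺ʳ us p , ++⁺ʳ vs q) , ℓ≤

common-map : ∀ {xs ys ℓ} f → HasCommon xs ys ℓ → HasCommon (map f xs) (map f ys) ℓ
common-map f (zs , (p , q) , ℓ≤) =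
  map f zs , (map⁺ f p , map⁺ f q) , subst (_ ≤_) (sym (length-map f zs)) ℓ≤

-- (3) The Thue–Morse sequence: t(2m) = t(m), t(2m+1) = ¬t(m), and the block
-- formula t(i·2^c + r) = t(i) xor t(r) for r < 2^c.

bitParity-zero : ∀ f → bitParity f 0 ≡ false
bitParity-zero zero    = refl
bitParity-zero (suc f) = bitParity-zero f

half-≤ : ∀ f m → m ≤ suc f → m / 2 ≤ f
half-≤ f zero    _         = z≤n
half-≤ f (suc m) (s≤s m≤f) = ≤-trans (≤-pred (m/n<m (suc m) 2 (s≤s (s≤s z≤n)))) m≤f

bitParity-fuel : ∀ f g m → m ≤ f → m ≤ g → bitParity f m ≡ bitParity g m
bitParity-fuel zero    g       .zero z≤n _   = sym (bitParity-zero g)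
bitParity-fuel (suc f) zero    .zero _   z≤n = bitParity-zero (suc f)
bitParity-fuel (suc f) (suc g) m     m≤f m≤g =
  cong ((m % 2 ≡ᵇ 1) xor_) (bitParity-fuel f g (m / 2) (half-≤ f m m≤f) (half-≤ g m m≤g))

t-unfold : ∀ m → t m ≡ (m % 2 ≡ᵇ 1) xor t (m / 2)
t-unfold zero    = refl
t-unfold (suc m) =
  cong ((suc m % 2 ≡ᵇ 1) xor_) (bitParity-fuel m (suc m / 2) (suc m / 2) (half-≤ m (suc m) ≤-refl) ≤-refl)

t-double : ∀ m → t (m * 2) ≡ t m
t-double m = trans (t-unfold (m * 2)) (cong₂ (λ b k → (b ≡ᵇ 1) xor t k) (m*n%n≡0 m 2) (m*n/n≡m m 2))

t-double+1 : ∀ m → t (1 + m * 2) ≡ not (t m)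
t-double+1 m = trans (t-unfold (1 + m * 2)) (cong₂ (λ b k → (b ≡ᵇ 1) xor t k) last-digit rest)
  where
  last-digit : (1 + m * 2) % 2 ≡ 1
  last-digit = [m+kn]%n≡m%n 1 m 2
  rest : (1 + m * 2) / 2 ≡ m
  rest = trans (+-distrib-/ 1 (m * 2) (subst (λ k → 1 + k < 2) (sym (m*n%n≡0 m 2)) ≤-refl))
               (m*n/n≡m m 2)

data Parity : ℕ → Set where
  even : ∀ m → Parity (m * 2)
  odd  : ∀ m → Parity (1 + m * 2)

parity : ∀ n → Parity n
parity zero = even 0
parity (suc n) with parity n
... | even m = odd m
... | odd  m = even (suc m)

-- the last c binary digits of i·2^c + r are those of r
t-block : ∀ c i r → r < 2 ^ c → t (i * 2 ^ c + r) ≡ t i xor t r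
t-block zero i .zero (s≤s z≤n) =
  trans (cong t (trans (+-identityʳ _) (*-identityʳ i))) (sym (xor-identityʳ (t i)))
t-block (suc c) i r r< with parity r
... | even r′ = begin
    t (i * (2 * 2 ^ c) + r′ * 2)   ≡⟨ cong t (shift-even i (2 ^ c) r′) ⟩
    t ((i * 2 ^ c + r′) * 2)       ≡⟨ t-double (i * 2 ^ c + r′) ⟩
    t (i * 2 ^ c + r′)             ≡⟨ t-block c i r′ (halve r′ r<) ⟩
    t i xor t r′                   ≡⟨ cong (t i xor_) (t-double r′) ⟨
    t i xor t (r′ * 2)             ∎
  where
  open ≡-Reasoning
  shift-even : ∀ i p r → i * (2 * p) + r * 2 ≡ (i * p + r) * 2
  shift-even = solve-∀
  halve : ∀ r → r * 2 < 2 ^ suc c → r < 2 ^ c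
  halve r r< = *-cancelʳ-< 2 r (2 ^ c) (subst (r * 2 <_) (*-comm 2 (2 ^ c)) r<)
... | odd r′ = begin
    t (i * (2 * 2 ^ c) + (1 + r′ * 2))   ≡⟨ cong t (shift-odd i (2 ^ c) r′) ⟩
    t (1 + (i * 2 ^ c + r′) * 2)         ≡⟨ t-double+1 (i * 2 ^ c + r′) ⟩
    not (t (i * 2 ^ c + r′))             ≡⟨ cong not (t-block c i r′ (halve r′ r<)) ⟩
    not (t i xor t r′)                   ≡⟨ not-distribʳ-xor (t i) (t r′) ⟩
    t i xor not (t r′)                   ≡⟨ cong (t i xor_) (t-double+1 r′) ⟨
    t i xor t (1 + r′ * 2)               ∎
  where
  open ≡-Reasoning
  shift-odd : ∀ i p r → i * (2 * p) + (1 + r * 2) ≡ 1 + (i * p + r) * 2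
  shift-odd = solve-∀
  halve : ∀ r → 1 + r * 2 < 2 ^ suc c → r < 2 ^ c
  halve r r< = *-cancelʳ-< 2 r (2 ^ c) (subst (r * 2 <_) (*-comm 2 (2 ^ c)) (<-trans (n<1+n _) r<))

window : (ℕ → Bool) → ℕ → ℕ → List Bool
window f a zero    = []
window f a (suc l) = f a ∷ window f (suc a) l

window-++ : ∀ f a l l′ → window f a (l + l′) ≡ window f a l ++ window f (a + l) l′
window-++ f a zero    l′ = cong (λ b → window f b l′) (sym (+-identityʳ a))
window-++ f a (suc l) l′ =
  cong (f a ∷_) (trans (window-++ f (suc a) l l′) (cong (λ b → window f (suc a) l ++ window f b l′) (sym (+-suc a l))))

window-map : ∀ h f a l → map h (window f a l) ≡ window (λ k → h (f k)) a l
window-map h f a zero    = refl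
window-map h f a (suc l) = cong (h (f a) ∷_) (window-map h f (suc a) l)

window-cong : ∀ f g a b l → (∀ r → r < l → f (a + r) ≡ g (b + r)) → window f a l ≡ window g b l
window-cong f g a b zero    _  = refl
window-cong f g a b (suc l) eq = cong₂ _∷_ first (window-cong f g (suc a) (suc b) l shifted)
  where
  first : f a ≡ g b
  first = trans (cong f (sym (+-identityʳ a))) (trans (eq 0 (s≤s z≤n)) (cong g (+-identityʳ b)))
  shifted : ∀ r → r < l → f (suc a + r) ≡ g (suc b + r)
  shifted r r< = trans (cong f (sym (+-suc a r))) (trans (eq (suc r) (s≤s r<)) (cong g (+-suc b r)))

window-length : ∀ f a l → length (window f a l) ≡ l
window-length f a zero    = refl
window-length f a (suc l) = cong suc (window-length f (suc a) l)

tabulate-window : ∀ n (g : Fin n → Bool) f a → (∀ i → g i ≡ f (a + toℕ i)) → tabulate g ≡ window f a n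
tabulate-window zero    g f a eq = refl
tabulate-window (suc n) g f a eq =
  cong₂ _∷_ (trans (eq fzero) (cong f (+-identityʳ a)))
            (tabulate-window n (λ i → g (fsuc i)) f (suc a) (λ i → trans (eq (fsuc i)) (cong f (+-suc a (toℕ i)))))

prefix-window : ∀ n → prefix n ≡ window t 0 n
prefix-window n = tabulate-window n (λ i → t (toℕ i)) t 0 (λ i → refl)

-- (5) Doubled block words and their alignment with their complement.

flipIf : Bool → List Bool → List Bool
flipIf b = map (b xor_)

length-flipIf : ∀ b w → length (flipIf b w) ≡ length w
length-flipIf b = length-map (b xor_)

complement-flipIf : ∀ b w → complement (flipIf b w) ≡ flipIf (not b) w
complement-flipIf b w = trans (sym (map-∘ w)) (map-cong (not-distribˡ-xor b) w)

flipIf-complement : ∀ b w → flipIf b (complement w) ≡ flipIf (not b) w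
flipIf-complement b w =
  trans (sym (map-∘ w)) (map-cong (λ x → trans (sym (not-distribʳ-xor b x)) (not-distribˡ-xor b x)) w)

doubled : List Bool → List Bool → List Bool
doubled u []       = []
doubled u (b ∷ bs) = flipIf b u ++ (flipIf (not b) u ++ doubled u bs)

complement-doubled : ∀ u bs → complement (doubled u bs) ≡ doubled u (map not bs)
complement-doubled u []       = refl
complement-doubled u (b ∷ bs) = begin
    complement (flipIf b u ++ (flipIf (not b) u ++ doubled u bs))
  ≡⟨ map-++ not (flipIf b u) _ ⟩
    complement (flipIf b u) ++ complement (flipIf (not b) u ++ doubled u bs)
  ≡⟨ cong (complement (flipIf b u) ++_) (map-++ not (flipIf (not b) u) (doubled u bs)) ⟩
    complement (flipIf b u) ++ (complement (flipIf (not b) u) ++ complement (doubled u bs))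
  ≡⟨ cong₂ _++_ (complement-flipIf b u)
                (cong₂ _++_ (complement-flipIf (not b) u) (complement-doubled u bs)) ⟩
    doubled u (not b ∷ map not bs) ∎
  where open ≡-Reasoning

-- Given a common subsequence of length ℓ₀ ≤ |u| of u and its complement, any two
-- blocks u^b, u^{b′} have a common subsequence of length ℓ₀; this lets a doubled
-- word, shifted by one block, be aligned with its complement.
module Alignment (u : List Bool) (ℓ₀ : ℕ)
                 (u-common : HasCommon u (complement u) ℓ₀) (ℓ₀≤ : ℓ₀ ≤ length u) where

  block-refl : ∀ b → HasCommon (flipIf b u) (flipIf b u) (length u)
  block-refl b = subst (HasCommon (flipIf b u) (flipIf b u)) (length-flipIf b u) (common-refl (flipIf b u))

  block-opposite : ∀ b → HasCommon (flipIf b u) (flipIf (not b) u) ℓ₀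
  block-opposite b = subst (λ w → HasCommon (flipIf b u) w ℓ₀) (flipIf-complement b u) (common-map (b xor_) u-common)

  block-match : ∀ b b′ → HasCommon (flipIf b u) (flipIf b′ u) ℓ₀
  block-match false false = common-weaken ℓ₀≤ (block-refl false)
  block-match true  true  = common-weaken ℓ₀≤ (block-refl true)
  block-match false true  = block-opposite false
  block-match true  false = block-opposite true

  -- u^b u^{b₀} u^{¬b₀} u^{b₁} ⋯  against  u^b u^{¬b} u^{¬b₀} u^{b₀} u^{¬b₁} ⋯ :
  -- u^b and every u^{¬bⱼ} match completely, each u^{bⱼ} matches the block
  -- u^{¬b} resp. u^{bⱼ₋₁} opposite to it in ℓ₀ letters
  shifted : ∀ b bs → HasCommon (flipIf b u ++ doubled u bs) (doubled u (b ∷ map not bs))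
                               (length u + length bs * (ℓ₀ + length u))
  shifted b [] =
    common-weaken (≤-reflexive (+-identityʳ (length u)))
                  (common-padʳ [] (flipIf (not b) u ++ []) (block-refl b))
  shifted b (b′ ∷ bs) =
    common-weaken (≤-reflexive (regroup (length u) ℓ₀ (length bs)))
                  (common-++ (block-refl b) (common-++ (block-match b′ (not b)) (shifted (not b′) bs)))
    where
    regroup : ∀ n l k → n + suc k * (l + n) ≡ n + (l + (n + k * (l + n)))
    regroup = solve-∀

  doubled-common : ∀ b bs → HasCommon (doubled u (b ∷ bs)) (complement (doubled u (b ∷ bs)))
                                      (length u + length bs * (ℓ₀ + length u))
  doubled-common b bs =
    subst (λ w → HasCommon (doubled u (b ∷ bs)) w _) (sym (complement-doubled u (b ∷ bs)))
          (common-padˡ (flipIf b u) (shifted (not b) bs))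

-- (6) A Thue–Morse prefix of length 2(q+1)·2^c is a doubled word over the
-- prefix of length 2^c, followed by a remainder.

module ThueMorseBlocks (c : ℕ) where

  L : ℕ
  L = 2 ^ c

  U : List Bool
  U = window t 0 L

  block : ∀ i → window t (i * L) L ≡ flipIf (t i) U
  block i = trans (window-cong t (λ r → t i xor t r) (i * L) 0 L (λ r r< → t-block c i r r<))
                  (sym (window-map (t i xor_) t 0 L))

  block-pair : ∀ j → window t (j * (2 * L)) (2 * L) ≡ flipIf (t j) U ++ flipIf (not (t j)) U
  block-pair j = begin
      window t (j * (2 * L)) (2 * L)
    ≡⟨ cong (window t (j * (2 * L))) (twice L) ⟩
      window t (j * (2 * L)) (L + L)
    ≡⟨ window-++ t (j * (2 * L)) L L ⟩
      window t (j * (2 * L)) L ++ window t (j * (2 * L) + L) L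
    ≡⟨ cong₂ (λ a b → window t a L ++ window t b L) (even-start j L) (odd-start j L) ⟩
      window t ((j * 2) * L) L ++ window t ((1 + j * 2) * L) L
    ≡⟨ cong₂ _++_ (trans (block (j * 2)) (cong (λ b → flipIf b U) (t-double j)))
                  (trans (block (1 + j * 2)) (cong (λ b → flipIf b U) (t-double+1 j))) ⟩
      flipIf (t j) U ++ flipIf (not (t j)) U ∎
    where
    open ≡-Reasoning
    twice : ∀ n → 2 * n ≡ n + n
    twice = solve-∀
    even-start : ∀ j n → j * (2 * n) ≡ (j * 2) * n
    even-start = solve-∀
    odd-start : ∀ j n → j * (2 * n) + n ≡ (1 + j * 2) * n
    odd-start = solve-∀

  blocks-doubled : ∀ m j → window t (j * (2 * L)) (m * (2 * L)) ≡ doubled U (window t j m)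
  blocks-doubled zero    j = refl
  blocks-doubled (suc m) j = begin
      window t (j * (2 * L)) (2 * L + m * (2 * L))
    ≡⟨ window-++ t (j * (2 * L)) (2 * L) (m * (2 * L)) ⟩
      window t (j * (2 * L)) (2 * L) ++ window t (j * (2 * L) + 2 * L) (m * (2 * L))
    ≡⟨ cong₂ _++_ (block-pair j)
                  (trans (cong (λ a → window t a (m * (2 * L))) (next-pair j L)) (blocks-doubled m (suc j))) ⟩
      (flipIf (t j) U ++ flipIf (not (t j)) U) ++ doubled U (window t (suc j) m)
    ≡⟨ ++-assoc (flipIf (t j) U) (flipIf (not (t j)) U) (doubled U (window t (suc j) m)) ⟩
      doubled U (window t j (suc m)) ∎
    where
    open ≡-Reasoning
    next-pair : ∀ j n → j * (2 * n) + 2 * n ≡ suc j * (2 * n)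
    next-pair = solve-∀

  prefix-common : ∀ ℓ₀ q r → HasCommon (prefix L) (complement (prefix L)) ℓ₀ → ℓ₀ ≤ L →
                  let n = suc q * (2 * L) + r in
                  HasCommon (prefix n) (complement (prefix n)) (L + q * (ℓ₀ + L))
  prefix-common ℓ₀ q r common ℓ₀≤ =
    subst (λ w → HasCommon w (complement w) (L + q * (ℓ₀ + L))) (sym prefix-split)
          (subst (λ w → HasCommon (X ++ R) w (L + q * (ℓ₀ + L))) (sym (map-++ not X R))
                 (common-padʳ R (complement R) (common-weaken (≤-reflexive count) aligned)))
    where
    X = doubled U (window t 0 (suc q))
    R = window t (suc q * (2 * L)) r
    prefix-split : prefix (suc q * (2 * L) + r) ≡ X ++ R
    prefix-split = trans (prefix-window _)
                         (trans (window-++ t 0 (suc q * (2 * L)) r)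
                                (cong (_++ R) (blocks-doubled (suc q) 0)))
    open Alignment U ℓ₀ (subst (λ w → HasCommon w (complement w) ℓ₀) (prefix-window L) common)
                        (subst (ℓ₀ ≤_) (sym (window-length t 0 L)) ℓ₀≤)
    aligned : HasCommon X (complement X) (length U + length (window t 1 q) * (ℓ₀ + length U))
    aligned = doubled-common (t 0) (window t 1 q)
    count : L + q * (ℓ₀ + L) ≡ length U + length (window t 1 q) * (ℓ₀ + length U)
    count = sym (cong₂ (λ l k → l + k * (ℓ₀ + l)) (window-length t 0 L) (window-length t 1 q))

-- (7) Arithmetic for the recursion n = 2(q+1)L + r, L = 2^c, c + a = ⌊log₂ n⌋,
-- a = ⌊⌊log₂ n⌋/4⌋: the new defect r + L + q·d₀ stays below 36n/⌊log₂ n⌋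
-- when the old one satisfies d₀·c ≤ 36L.

1+n≤2^n : ∀ n → 1 + n ≤ 2 ^ n
1+n≤2^n zero    = s≤s z≤n
1+n≤2^n (suc n) =
  ≤-trans (≤-reflexive (+-comm 1 (1 + n)))
          (+-mono-≤ (1+n≤2^n n) (m≤n⇒m≤n+o 0 (m^n>0 2 n)))

-- the remainder together with the dropped first block
head-bound : ∀ n K a L r → K < 4 + a * 4 → L * 2 ^ a ≤ n → r < 2 * L → (r + L) * K ≤ 12 * n
head-bound n K a L r K< L2^a≤n r< = begin
    (r + L) * K                  ≤⟨ *-mono-≤ (+-monoˡ-≤ L (<⇒≤ r<)) (<⇒≤ K<) ⟩
    (2 * L + L) * (4 + a * 4)    ≡⟨ regroup L a ⟩
    12 * (L * (1 + a))           ≤⟨ *-monoʳ-≤ 12 (*-monoʳ-≤ L (1+n≤2^n a)) ⟩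
    12 * (L * 2 ^ a)             ≤⟨ *-monoʳ-≤ 12 L2^a≤n ⟩
    12 * n                       ∎
  where
  open ≤-Reasoning
  regroup : ∀ L a → (2 * L + L) * (4 + a * 4) ≡ 12 * (L * (1 + a))
  regroup = solve-∀

-- the q block pairs matched only up to the old defect d₀; uses 3K ≤ 4c
tail-bound : ∀ n c a L q d₀ → a * 4 ≤ c + a → q * (2 * L) ≤ n → d₀ * c ≤ 36 * L →
             q * d₀ * (c + a) ≤ 24 * n
tail-bound n c a L q d₀ 4a≤K q2L≤n d₀c≤ = *-cancelˡ-≤ 3 (begin
    3 * (q * d₀ * (c + a))       ≡⟨ regroup₁ q d₀ (c + a) ⟩
    q * d₀ * (3 * (c + a))       ≤⟨ *-monoʳ-≤ (q * d₀) 3K≤4c ⟩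
    q * d₀ * (4 * c)             ≡⟨ regroup₂ q d₀ c ⟩
    4 * (q * (d₀ * c))           ≤⟨ *-monoʳ-≤ 4 (*-monoʳ-≤ q d₀c≤) ⟩
    4 * (q * (36 * L))           ≡⟨ regroup₃ q L ⟩
    72 * (q * (2 * L))           ≤⟨ *-monoʳ-≤ 72 q2L≤n ⟩
    72 * n                       ≡⟨ *-assoc 3 24 n ⟩
    3 * (24 * n)                 ∎)
  where
  open ≤-Reasoning
  regroup₁ : ∀ q d K → 3 * (q * d * K) ≡ q * d * (3 * K)
  regroup₁ = solve-∀
  regroup₂ : ∀ q d c → q * d * (4 * c) ≡ 4 * (q * (d * c))
  regroup₂ = solve-∀
  regroup₃ : ∀ q L → 4 * (q * (36 * L)) ≡ 72 * (q * (2 * L))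
  regroup₃ = solve-∀
  expand : ∀ c a → 3 * (c + a) ≡ 3 * c + a * 3
  expand = solve-∀
  3a≤c : a * 3 ≤ c
  3a≤c = +-cancelʳ-≤ a (a * 3) c (≤-trans (≤-reflexive (split-four a)) 4a≤K)
    where
    split-four : ∀ a → a * 3 + a ≡ a * 4
    split-four = solve-∀
  3K≤4c : 3 * (c + a) ≤ 4 * c
  3K≤4c = ≤-trans (≤-reflexive (expand c a))
                  (≤-trans (+-monoʳ-≤ (3 * c) 3a≤c) (≤-reflexive (+-comm (3 * c) c)))

defect-bound : ∀ n c a L r q d₀ → a * 4 ≤ c + a → c + a < 4 + a * 4 → L * 2 ^ a ≤ n →
               r < 2 * L → q * (2 * L) ≤ n → d₀ * c ≤ 36 * L →
               (r + L + q * d₀) * (c + a) ≤ 36 * n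
defect-bound n c a L r q d₀ 4a≤K K< L2^a≤n r< q2L≤n d₀c≤ = begin
    (r + L + q * d₀) * (c + a)              ≡⟨ *-distribʳ-+ (c + a) (r + L) (q * d₀) ⟩
    (r + L) * (c + a) + q * d₀ * (c + a)    ≤⟨ +-mono-≤ (head-bound n (c + a) a L r K< L2^a≤n r<)
                                                         (tail-bound n c a L q d₀ 4a≤K q2L≤n d₀c≤) ⟩
    12 * n + 24 * n                         ≡⟨ *-distribʳ-+ n 12 24 ⟨
    36 * n                                  ∎
  where open ≤-Reasoning

2^⌊log2⌋≤ : ∀ m (ac : Acc _<_ (suc m)) → 2 ^ ⌊log2⌋ (suc m) ac ≤ suc m
2^⌊log2⌋≤ zero    _        = s≤s z≤n
2^⌊log2⌋≤ (suc m) (acc rs) = ≤-trans (*-monoʳ-≤ 2 (2^⌊log2⌋≤ ⌊ m /2⌋ _)) double-half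
  where
  open ≤-Reasoning
  double-suc : ∀ x → 2 * suc x ≡ 2 + (x + x)
  double-suc = solve-∀
  double-half : 2 * suc ⌊ m /2⌋ ≤ suc (suc m)
  double-half = begin
    2 * suc ⌊ m /2⌋             ≡⟨ double-suc ⌊ m /2⌋ ⟩
    2 + (⌊ m /2⌋ + ⌊ m /2⌋)     ≤⟨ +-monoʳ-≤ 2 (+-monoʳ-≤ ⌊ m /2⌋ (⌊n/2⌋≤⌈n/2⌉ m)) ⟩
    2 + (⌊ m /2⌋ + ⌈ m /2⌉)     ≡⟨ cong (2 +_) (⌊n/2⌋+⌈n/2⌉≡n m) ⟩
    suc (suc m)                 ∎

2^⌊log₂⌋≤ : ∀ m → 2 ^ ⌊log₂ suc m ⌋ ≤ suc m
2^⌊log₂⌋≤ m = 2^⌊log2⌋≤ m (<-wellFounded (suc m))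

quarter-split : ∀ K → 4 ≤ K → Σ ℕ λ c → Σ ℕ λ a → c + a ≡ K × a * 4 ≤ K × K < 4 + a * 4 × 1 ≤ a
quarter-split K 4≤K = K ∸ K / 4 , K / 4 , m∸n+n≡m (≤-trans (m≤m*n (K / 4) 4) (m/n*n≤m K 4))
                    , m/n*n≤m K 4 , K< , m≥n⇒m/n>0 4≤K
  where
  K< : K < 4 + K / 4 * 4
  K< = subst (_< 4 + K / 4 * 4) (sym (m≡m%n+[m/n]*n K 4)) (+-monoˡ-< (K / 4 * 4) (m%n<n K 4))

-- (8) The defect bound for all n, by strong induction.

SmallDefect : ℕ → Set
SmallDefect n = Σ ℕ λ ℓ → Σ ℕ λ d →
  HasCommon (prefix n) (complement (prefix n)) ℓ × ℓ + d ≡ n × d * ⌊log₂ n ⌋ ≤ 36 * n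

-- while ⌊log₂ n⌋ ≤ 36 the empty subsequence suffices
smallDefect-trivial : ∀ n → ⌊log₂ n ⌋ ≤ 36 → SmallDefect n
smallDefect-trivial n K≤36 =
  0 , n , ([] , (minimum _ , minimum _) , z≤n) , refl , ≤-trans (*-monoʳ-≤ n K≤36) (≤-reflexive (*-comm n 36))

pair-fits : ∀ n c a → 1 ≤ a → 2 ^ c * 2 ^ a ≤ n → 2 * 2 ^ c ≤ n
pair-fits n c a 1≤a L2^a≤n =
  ≤-trans (≤-reflexive (*-comm 2 (2 ^ c))) (≤-trans (*-monoʳ-≤ (2 ^ c) (^-monoʳ-≤ 2 1≤a)) L2^a≤n)

divide : ∀ n m → .{{NonZero m}} → m ≤ n → Σ ℕ λ q → Σ ℕ λ r → n ≡ suc q * m + r × r < m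
divide n m m≤n with n / m | m≥n⇒m/n>0 m≤n | m≡m%n+[m/n]*n n m
... | suc q | _ | n≡r+qm = q , n % m , trans n≡r+qm (+-comm (n % m) _) , m%n<n n m

smallDefect-step : ∀ n c a → c + a ≡ ⌊log₂ n ⌋ → a * 4 ≤ ⌊log₂ n ⌋ → ⌊log₂ n ⌋ < 4 + a * 4 →
                   1 ≤ a → 2 ^ c * 2 ^ a ≤ n → SmallDefect (2 ^ c) → SmallDefect n
smallDefect-step n c a c+a≡K 4a≤K K< 1≤a L2^a≤n (ℓ₀ , d₀ , common₀ , ℓ₀+d₀≡L , bound₀)
  with divide n (2 * 2 ^ c) {{m*n≢0 2 (2 ^ c) {{_}} {{m^n≢0 2 c}}}} (pair-fits n c a 1≤a L2^a≤n)
... | q , r , n≡ , r< =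
  L + q * (ℓ₀ + L) , r + L + q * d₀ ,
  subst (λ m → HasCommon (prefix m) (complement (prefix m)) _) (sym n≡) (prefix-common ℓ₀ q r common₀ ℓ₀≤L) ,
  trans (defect-sum ℓ₀+d₀≡L) (sym n≡) ,
  subst (λ K → (r + L + q * d₀) * K ≤ 36 * n) c+a≡K
        (defect-bound n c a L r q d₀ (subst (a * 4 ≤_) (sym c+a≡K) 4a≤K) (subst (_< 4 + a * 4) (sym c+a≡K) K<)
                      L2^a≤n r< q2L≤n d₀c≤)
  where
  open ThueMorseBlocks c
  ℓ₀≤L : ℓ₀ ≤ L
  ℓ₀≤L = subst (ℓ₀ ≤_) ℓ₀+d₀≡L (m≤m+n ℓ₀ d₀)
  q2L≤n : q * (2 * L) ≤ n
  q2L≤n = subst (q * (2 * L) ≤_) (sym n≡) (≤-trans (m≤n+m _ (2 * L)) (m≤m+n _ r))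
  d₀c≤ : d₀ * c ≤ 36 * L
  d₀c≤ = subst (λ k → d₀ * k ≤ 36 * L) (⌊log₂[2^n]⌋≡n c) bound₀
  defect-sum : ℓ₀ + d₀ ≡ L → (L + q * (ℓ₀ + L)) + (r + L + q * d₀) ≡ suc q * (2 * L) + r
  defect-sum ℓ₀+d₀≡L = subst (λ L′ → (L′ + q * (ℓ₀ + L′)) + (r + L′ + q * d₀) ≡ suc q * (2 * L′) + r)
                             ℓ₀+d₀≡L (regroup ℓ₀ d₀ q r)
    where
    regroup : ∀ ℓ₀ d₀ q r → (ℓ₀ + d₀ + q * (ℓ₀ + (ℓ₀ + d₀))) + (r + (ℓ₀ + d₀) + q * d₀)
                           ≡ suc q * (2 * (ℓ₀ + d₀)) + r
    regroup = solve-∀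

smallDefect : ∀ n → SmallDefect n
smallDefect = <-rec SmallDefect step
  where
  step : ∀ n → (∀ {m} → m < n → SmallDefect m) → SmallDefect n
  step zero    _  = smallDefect-trivial 0 z≤n
  step (suc m) ih with 4 ≤? ⌊log₂ suc m ⌋
  ... | no  K≱4 = smallDefect-trivial (suc m) (≤-trans (≤-pred (≰⇒> K≱4)) (m≤m+n 3 33))
  ... | yes 4≤K with quarter-split ⌊log₂ suc m ⌋ 4≤K
  ...   | c , a , c+a≡K , 4a≤K , K< , 1≤a = smallDefect-step (suc m) c a c+a≡K 4a≤K K< 1≤a L2^a≤n (ih L<n)
    where
    L2^a≤n : 2 ^ c * 2 ^ a ≤ suc m
    L2^a≤n = subst (_≤ suc m) (trans (cong (2 ^_) (sym c+a≡K)) (^-distribˡ-+-* 2 c a)) (2^⌊log₂⌋≤ m)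
    L<n : 2 ^ c < suc m
    L<n = <-≤-trans (m<m+n (2 ^ c) (m≤n⇒m≤n+o 0 (m^n>0 2 c))) (pair-fits (suc m) c a 1≤a L2^a≤n)

b : ℕ → ℕ
b n = size (lcs (prefix n) (complement (prefix n)))

b-≤ : ∀ n → b n ≤ n
b-≤ n = ≤-trans (lcs-≤-length (prefix n) _) (≤-reflexive (length-tabulate {n = n} _))

-- the defect of the exact LCS is at most the defect of any common subsequence
b-defect : ∀ n → (n ∸ b n) * ⌊log₂ n ⌋ ≤ 36 * n
b-defect n with smallDefect n
... | ℓ , d , (zs , common , ℓ≤|zs|) , ℓ+d≡n , d-bound = ≤-trans (*-monoˡ-≤ ⌊log₂ n ⌋ n∸b≤d) d-bound
  where
  ℓ≤b : ℓ ≤ b n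
  ℓ≤b = ≤-trans ℓ≤|zs| (lcs-≥ (prefix n) (complement (prefix n)) zs common)
  n∸b≤d : n ∸ b n ≤ d
  n∸b≤d = ≤-trans (∸-monoʳ-≤ n ℓ≤b) (≤-reflexive (trans (cong (_∸ ℓ) (sym ℓ+d≡n)) (m+n∸m≡n ℓ d)))

corollary3 : Σ ℕ (λ C → Σ ℕ (λ N → (n : ℕ) → N ≤ n →
    Σ ℕ (λ k → IsB n k × k ≤ n × (n ∸ k) * ⌊log₂ n ⌋ ≤ C * n)))
corollary3 = 36 , 0 , λ n _ → b n , lcs-isLCS (prefix n) (complement (prefix n)) , b-≤ n , b-defect n
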